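{- There are infinitely many weak Carmichael numbers.
   Context: A composite positive integer $n$ is called a weak Carmichael number if $\sum_{1\le k\le n-1,\ \gcd(k,n)=1} k^{n-1}\equiv \varphi(n)\pmod{n}$, where $\varphi$ is Euler's totient function. -}

module Defs where

open import Data.Nat using (ℕ; zero; suc; _+_; _∸_; _^_; _%_; NonZero)
open import Data.Nat.GCD using (gcd)
open import Data.Nat.Primality using (Composite; composite⇒nonZero)
open import Data.Product using (_×_; Σ)
open import Relation.Binary.PropositionalEquality using (_≡_)
open import Relation.Nullary using (yes; no)
open import Data.Nat using (_≟_)

coprimeSum : (n : ℕ) → (ℕ → ℕ) → ℕ → ℕ
coprimeSum n f zero = 0
coprimeSum n f (suc m) with gcd (suc m) n ≟ 1
... | yes _ = f (suc m) + coprimeSum n f m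
... | no _  = coprimeSum n f m

φ : ℕ → ℕ
φ n = coprimeSum n (λ _ → 1) n

WeakCarmichael : ℕ → Set
WeakCarmichael n =
  Σ (Composite n) λ c →
    let instance _ = composite⇒nonZero c in
    coprimeSum n (λ k → k ^ (n ∸ 1)) (n ∸ 1) % n ≡ φ n % n

module Submission where

-- Every power n = 3^(t+1) with t ≥ 1 is a weak Carmichael number.
--
-- For a prime p, the integers coprime to p^(t+1) are exactly those not
-- divisible by p, so the sum in the definition is a sum of k^e over the
-- k ≤ n not divisible by 3.  Write S_e(M) for that sum over 1 ≤ k ≤ M.
-- If 3 ∣ M then the residues k, M + k, 2M + k (1 ≤ k ≤ M) cover 1..3M, and
-- by the binomial theorem (k + M)^e ≡ k^e + eMk^(e-1) (mod 3M), because
-- 3M ∣ M².  Summing the three translates gives S_e(3M) ≡ 3·S_e(M) (mod 3M).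
-- Starting from S_e(3) = 1 + 2^e ≡ 2 (mod 3) for even e, induction gives
-- S_e(3^(t+1)) ≡ 2·3^t (mod 3^(t+1)) for every even e.  Since n - 1 is even
-- and φ(n) = S_0(n), both sides of the defining congruence are ≡ 2·3^t.

open import Defs
open import Data.Nat
open import Data.Nat.Properties
open import Data.Nat.DivMod
open import Data.Nat.Divisibility
open import Data.Nat.GCD using (gcd; gcd-greatest)
open import Data.Nat.Coprimality using (Coprime; coprime-divisor; coprime⇒gcd≡1)
open import Data.Nat.Primality
  using (Prime; Composite; prime?; prime⇒irreducible; prime⇒nonTrivial; composite)
open import Data.Nat.Tactic.RingSolver using (solve-∀)
open import Data.Product using (∃; _×_; _,_)
open import Data.Sum using (inj₁; inj₂)
open import Data.Empty using (⊥-elim)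
open import Relation.Nullary using (¬_; yes; no)
open import Relation.Nullary.Decidable using (from-yes)
open import Relation.Binary.PropositionalEquality
open ≡-Reasoning

module _ {D : ℕ} .{{_ : NonZero D}} where

  +-cong-mod : ∀ {a a' b b'} → a % D ≡ a' % D → b % D ≡ b' % D →
               (a + b) % D ≡ (a' + b') % D
  +-cong-mod {a} {a'} {b} {b'} a≡a' b≡b' = begin
    (a + b) % D           ≡⟨ %-distribˡ-+ a b D ⟩
    (a % D + b % D) % D   ≡⟨ cong₂ (λ u v → (u + v) % D) a≡a' b≡b' ⟩
    (a' % D + b' % D) % D ≡⟨ %-distribˡ-+ a' b' D ⟨
    (a' + b') % D         ∎

  *-congˡ-mod : ∀ k {a b} → a % D ≡ b % D → (k * a) % D ≡ (k * b) % D
  *-congˡ-mod k {a} {b} a≡b = begin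
    (k * a) % D             ≡⟨ %-distribˡ-* k a D ⟩
    (k % D * (a % D)) % D   ≡⟨ cong (λ u → (k % D * u) % D) a≡b ⟩
    (k % D * (b % D)) % D   ≡⟨ %-distribˡ-* k b D ⟨
    (k * b) % D             ∎

  ^-one-mod : ∀ {a} → a % D ≡ 1 % D → ∀ q → a ^ q % D ≡ 1 % D
  ^-one-mod a≡1 zero    = refl
  ^-one-mod {a} a≡1 (suc q) = begin
    a * a ^ q % D ≡⟨ *-congˡ-mod a (^-one-mod a≡1 q) ⟩
    a * 1 % D     ≡⟨ cong (_% D) (*-identityʳ a) ⟩
    a % D         ≡⟨ a≡1 ⟩
    1 % D         ∎

*-scale-mod : ∀ k {a b n} .{{_ : NonZero n}} .{{_ : NonZero (k * n)}} →
              a % n ≡ b % n → (k * a) % (k * n) ≡ (k * b) % (k * n)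
*-scale-mod k {a} {b} {n} a≡b = begin
  (k * a) % (k * n)                       ≡⟨ cong (_% (k * n)) (split a) ⟩
  (k * (a % n) + a / n * (k * n)) % (k * n) ≡⟨ [m+kn]%n≡m%n _ (a / n) (k * n) ⟩
  (k * (a % n)) % (k * n)                 ≡⟨ cong (λ r → (k * r) % (k * n)) a≡b ⟩
  (k * (b % n)) % (k * n)                 ≡⟨ [m+kn]%n≡m%n _ (b / n) (k * n) ⟨
  (k * (b % n) + b / n * (k * n)) % (k * n) ≡⟨ cong (_% (k * n)) (split b) ⟨
  (k * b) % (k * n)                       ∎
  where
  distribute : ∀ k r q n → k * (r + q * n) ≡ k * r + q * (k * n)
  distribute = solve-∀
  split : ∀ a → k * a ≡ k * (a % n) + a / n * (k * n)
  split a = trans (cong (k *_) (m≡m%n+[m/n]*n a n)) (distribute k (a % n) (a / n) n)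

binomial-linear : ∀ {D} .{{_ : NonZero D}} x y → D ∣ y * y → ∀ e →
                  (x + y) ^ suc e % D ≡ (x ^ suc e + y * (suc e * x ^ e)) % D
binomial-linear {D} x y D∣y² zero = cong (_% D) (expand x y)
  where
  expand : ∀ x y → (x + y) * 1 ≡ x * 1 + y * (1 * 1)
  expand = solve-∀
binomial-linear {D} x y D∣y² (suc e) = begin
  (x + y) * (x + y) ^ suc e % D
    ≡⟨ *-congˡ-mod (x + y) (binomial-linear x y D∣y² e) ⟩
  (x + y) * (x ^ suc e + y * (suc e * x ^ e)) % D
    ≡⟨ cong (_% D) (expand x y e (x ^ e)) ⟩
  (x ^ suc (suc e) + y * (suc (suc e) * x ^ suc e) + y * y * (suc e * x ^ e)) % D
    ≡⟨ %-remove-+ʳ _ (∣-trans D∣y² (m∣m*n (suc e * x ^ e))) ⟩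
  (x ^ suc (suc e) + y * (suc (suc e) * x ^ suc e)) % D
    ∎
  where
  expand : ∀ x y e p → (x + y) * (x * p + y * (suc e * p))
                     ≡ x * (x * p) + y * (suc (suc e) * (x * p)) + y * y * (suc e * p)
  expand = solve-∀

-- If 3 ∣ M, the three translates x, M + x, 2M + x contribute 3·x^e mod 3M:
-- the linear binomial terms add up to e·x^(e-1)·3M.
three-translates : ∀ M .{{_ : NonZero (3 * M)}} → 3 ∣ M → ∀ e x →
  (x ^ e + ((M + x) ^ e + (M + (M + x)) ^ e)) % (3 * M) ≡ (3 * x ^ e) % (3 * M)
three-translates M 3∣M zero    x = refl
three-translates M 3∣M (suc e) x = begin
  (x ^ suc e + ((M + x) ^ suc e + (M + (M + x)) ^ suc e)) % (3 * M)
    ≡⟨ cong (λ u → (x ^ suc e + u) % (3 * M))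
            (cong₂ (λ a b → a ^ suc e + b ^ suc e) (+-comm M x) (trans (sym (+-assoc M M x)) (+-comm (M + M) x))) ⟩
  (x ^ suc e + ((x + M) ^ suc e + (x + (M + M)) ^ suc e)) % (3 * M)
    ≡⟨ +-cong-mod {a = x ^ suc e} refl
         (+-cong-mod (binomial-linear x M 3M∣M² e) (binomial-linear x (M + M) 3M∣[2M]² e)) ⟩
  (x ^ suc e + ((x ^ suc e + M * r) + (x ^ suc e + (M + M) * r))) % (3 * M)
    ≡⟨ cong (_% (3 * M)) (collect (x ^ suc e) M r) ⟩
  (3 * x ^ suc e + r * (3 * M)) % (3 * M)
    ≡⟨ [m+kn]%n≡m%n (3 * x ^ suc e) r (3 * M) ⟩
  (3 * x ^ suc e) % (3 * M)
    ∎
  where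
  r : ℕ
  r = suc e * x ^ e
  3M∣M² : 3 * M ∣ M * M
  3M∣M² = *-monoˡ-∣ M 3∣M
  3M∣[2M]² : 3 * M ∣ (M + M) * (M + M)
  3M∣[2M]² = ∣-trans 3M∣M² (divides 4 (quadruple M))
    where quadruple : ∀ M → (M + M) * (M + M) ≡ 4 * (M * M)
          quadruple = solve-∀
  collect : ∀ p M r → p + ((p + M * r) + (p + (M + M) * r)) ≡ 3 * p + r * (3 * M)
  collect = solve-∀

Sum : (ℕ → ℕ) → ℕ → ℕ
Sum g zero    = 0
Sum g (suc m) = g (suc m) + Sum g m

Sum-ext : ∀ {g g'} → (∀ j → g j ≡ g' j) → ∀ m → Sum g m ≡ Sum g' m
Sum-ext g≡g' zero    = refl
Sum-ext g≡g' (suc m) = cong₂ _+_ (g≡g' (suc m)) (Sum-ext g≡g' m)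

Sum-cong-mod : ∀ {D} .{{_ : NonZero D}} {g g'} → (∀ j → g j % D ≡ g' j % D) →
               ∀ m → Sum g m % D ≡ Sum g' m % D
Sum-cong-mod g≡g' zero    = refl
Sum-cong-mod g≡g' (suc m) = +-cong-mod (g≡g' (suc m)) (Sum-cong-mod g≡g' m)

Sum-+ : ∀ g g' m → Sum (λ j → g j + g' j) m ≡ Sum g m + Sum g' m
Sum-+ g g' zero    = refl
Sum-+ g g' (suc m) = begin
  g (suc m) + g' (suc m) + Sum (λ j → g j + g' j) m
    ≡⟨ cong (g (suc m) + g' (suc m) +_) (Sum-+ g g' m) ⟩
  g (suc m) + g' (suc m) + (Sum g m + Sum g' m)
    ≡⟨ +-interchange (g (suc m)) (g' (suc m)) (Sum g m) (Sum g' m) ⟩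
  g (suc m) + Sum g m + (g' (suc m) + Sum g' m)
    ∎
  where
  +-interchange : ∀ a b c d → a + b + (c + d) ≡ a + c + (b + d)
  +-interchange = solve-∀

Sum-* : ∀ k g m → Sum (λ j → k * g j) m ≡ k * Sum g m
Sum-* k g zero    = sym (*-zeroʳ k)
Sum-* k g (suc m) = trans (cong (k * g (suc m) +_) (Sum-* k g m)) (sym (*-distribˡ-+ k _ _))

Sum-split : ∀ g a b → Sum g (a + b) ≡ Sum g a + Sum (λ j → g (a + j)) b
Sum-split g a zero    = trans (cong (Sum g) (+-identityʳ a)) (sym (+-identityʳ _))
Sum-split g a (suc b) = begin
  Sum g (a + suc b)                   ≡⟨ cong (Sum g) (+-suc a b) ⟩
  g (suc (a + b)) + Sum g (a + b)     ≡⟨ cong₂ _+_ (cong g (sym (+-suc a b))) (Sum-split g a b) ⟩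
  g (a + suc b) + (Sum g a + rest)    ≡⟨ +-comm-assoc (g (a + suc b)) (Sum g a) rest ⟩
  Sum g a + (g (a + suc b) + rest)    ∎
  where
  rest : ℕ
  rest = Sum (λ j → g (a + j)) b
  +-comm-assoc : ∀ x y z → x + (y + z) ≡ y + (x + z)
  +-comm-assoc = solve-∀

Sum-three-blocks : ∀ g M →
  Sum g (3 * M) ≡ Sum (λ j → g j + (g (M + j) + g (M + (M + j)))) M
Sum-three-blocks g M = begin
  Sum g (M + (M + (M + 0)))
    ≡⟨ cong (λ u → Sum g (M + (M + u))) (+-identityʳ M) ⟩
  Sum g (M + (M + M))
    ≡⟨ Sum-split g M (M + M) ⟩
  Sum g M + Sum (λ j → g (M + j)) (M + M)
    ≡⟨ cong (Sum g M +_) (Sum-split (λ j → g (M + j)) M M) ⟩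
  Sum g M + (Sum (λ j → g (M + j)) M + Sum (λ j → g (M + (M + j))) M)
    ≡⟨ cong (Sum g M +_) (Sum-+ (λ j → g (M + j)) (λ j → g (M + (M + j))) M) ⟨
  Sum g M + Sum (λ j → g (M + j) + g (M + (M + j))) M
    ≡⟨ Sum-+ g (λ j → g (M + j) + g (M + (M + j))) M ⟨
  Sum (λ j → g j + (g (M + j) + g (M + (M + j)))) M
    ∎

unlessZero : ℕ → ℕ → ℕ
unlessZero zero    v = 0
unlessZero (suc _) v = v

unlessZero-≢0 : ∀ {r} v → r ≢ 0 → unlessZero r v ≡ v
unlessZero-≢0 {zero}  v r≢0 = ⊥-elim (r≢0 refl)
unlessZero-≢0 {suc r} v r≢0 = refl

primeTo : (p : ℕ) .{{_ : NonZero p}} → (ℕ → ℕ) → ℕ → ℕ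
primeTo p f j = unlessZero (j % p) (f j)

primeTo-shift : ∀ {p} .{{_ : NonZero p}} f {a} → p ∣ a → ∀ j →
                primeTo p f (a + j) ≡ primeTo p (λ i → f (a + i)) j
primeTo-shift f p∣a j = cong (λ r → unlessZero r _) (%-remove-+ˡ j p∣a)

Sum-primeTo-drop : ∀ {p} .{{_ : NonZero p}} f n .{{_ : NonZero n}} → p ∣ n →
                   Sum (primeTo p f) (n ∸ 1) ≡ Sum (primeTo p f) n
Sum-primeTo-drop {p} f (suc m) p∣n =
  cong (λ r → unlessZero r (f (suc m)) + Sum (primeTo p f) m) (sym (n∣m⇒m%n≡0 (suc m) p p∣n))

coprime-primePower : ∀ {p j} → Prime p → ¬ p ∣ j → ∀ t → Coprime j (p ^ t)
coprime-primePower pp p∤j zero    (_ , i∣1) = ∣1⇒≡1 i∣1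
coprime-primePower pp p∤j (suc t) {i} (i∣j , i∣p^[1+t]) =
  coprime-primePower pp p∤j t (i∣j , coprime-divisor i⊥p i∣p^[1+t])
  where
  i⊥p : Coprime i _
  i⊥p (d∣i , d∣p) with prime⇒irreducible pp d∣p
  ... | inj₁ d≡1  = d≡1
  ... | inj₂ refl = ⊥-elim (p∤j (∣-trans d∣i i∣j))

-- For n = p^(t+1), gcd(j, n) = 1 exactly when p ∤ j; so the coprime sum
-- of Defs is the sum of f restricted to integers not divisible by p.
coprimeSum-primePower : ∀ {p} .{{_ : NonZero p}} → Prime p → ∀ t f m →
                        coprimeSum (p ^ suc t) f m ≡ Sum (primeTo p f) m
coprimeSum-primePower pp t f zero = refl
coprimeSum-primePower {p} pp t f (suc m) with gcd (suc m) (p ^ suc t) ≟ 1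
... | yes gcd≡1 = cong₂ _+_ (sym (unlessZero-≢0 (f (suc m)) p∤)) (coprimeSum-primePower pp t f m)
  where
  p∤ : suc m % p ≢ 0
  p∤ r≡0 = nonTrivial⇒≢1 {{prime⇒nonTrivial pp}}
    (∣1⇒≡1 (subst (p ∣_) gcd≡1 (gcd-greatest (m%n≡0⇒n∣m (suc m) p r≡0) (m∣m*n (p ^ t)))))
... | no gcd≢1 with suc m % p ≟ 0
...   | yes r≡0 = trans (coprimeSum-primePower pp t f m)
                        (cong (λ r → unlessZero r (f (suc m)) + Sum (primeTo p f) m) (sym r≡0))
...   | no r≢0  = ⊥-elim (gcd≢1 (coprime⇒gcd≡1
                    (coprime-primePower pp (λ p∣ → r≢0 (n∣m⇒m%n≡0 (suc m) p p∣)) (suc t))))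

powerSum : ℕ → ℕ → ℕ
powerSum e = Sum (primeTo 3 (_^ e))

unlessZero-triple : ∀ {D} .{{_ : NonZero D}} {a b c} r →
  (a + (b + c)) % D ≡ (3 * a) % D →
  (unlessZero r a + (unlessZero r b + unlessZero r c)) % D ≡ (3 * unlessZero r a) % D
unlessZero-triple zero    _   = refl
unlessZero-triple (suc r) abc = abc

powerSum-tripling : ∀ e M .{{_ : NonZero (3 * M)}} → 3 ∣ M →
  powerSum e (3 * M) % (3 * M) ≡ (3 * powerSum e M) % (3 * M)
powerSum-tripling e M 3∣M = begin
  Sum g (3 * M) % (3 * M)
    ≡⟨ cong (_% (3 * M)) (Sum-three-blocks g M) ⟩
  Sum (λ j → g j + (g (M + j) + g (M + (M + j)))) M % (3 * M)
    ≡⟨ cong (_% (3 * M)) (Sum-ext translate M) ⟩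
  Sum (λ j → g j + (primeTo 3 (λ i → (M + i) ^ e) j
                   + primeTo 3 (λ i → (M + (M + i)) ^ e) j)) M % (3 * M)
    ≡⟨ Sum-cong-mod (λ j → unlessZero-triple (j % 3) (three-translates M 3∣M e j)) M ⟩
  Sum (λ j → 3 * g j) M % (3 * M)
    ≡⟨ cong (_% (3 * M)) (Sum-* 3 g M) ⟩
  (3 * Sum g M) % (3 * M)
    ∎
  where
  g : ℕ → ℕ
  g = primeTo 3 (_^ e)
  translate : ∀ j → g j + (g (M + j) + g (M + (M + j)))
                  ≡ g j + (primeTo 3 (λ i → (M + i) ^ e) j + primeTo 3 (λ i → (M + (M + i)) ^ e) j)
  translate j = cong₂ (λ u v → g j + (u + v))
    (primeTo-shift (_^ e) 3∣M j)
    (trans (primeTo-shift (_^ e) 3∣M (M + j)) (primeTo-shift (λ i → (M + i) ^ e) 3∣M j))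

3^-nonZero : ∀ t → NonZero (3 ^ t)
3^-nonZero t = m^n≢0 3 t

-- Iterating from S_e(3) = 1 + 2^e: for even e, S_e(3^(t+1)) ≡ 2·3^t (mod 3^(t+1)).
powerSum-3^ : ∀ e → 2 ^ e % 3 ≡ 1 → ∀ t .{{_ : NonZero (3 ^ suc t)}} →
  powerSum e (3 ^ suc t) % 3 ^ suc t ≡ (2 * 3 ^ t) % 3 ^ suc t
powerSum-3^ e 2^e≡1 zero =
  +-cong-mod {a = 2 ^ e} {a' = 1} {b = 1 ^ e + 0} {b' = 1} 2^e≡1 (cong (λ u → (u + 0) % 3) (^-zeroˡ e))
powerSum-3^ e 2^e≡1 (suc t) = begin
  powerSum e (3 * M) % (3 * M)   ≡⟨ powerSum-tripling e M (m∣m*n (3 ^ t)) ⟩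
  (3 * powerSum e M) % (3 * M)   ≡⟨ *-scale-mod 3 {n = M} induction-hypothesis ⟩
  (3 * (2 * 3 ^ t)) % (3 * M)    ≡⟨ cong (_% (3 * M)) (*-comm-assoc 3 2 (3 ^ t)) ⟩
  (2 * 3 ^ suc t) % (3 * M)      ∎
  where
  M : ℕ
  M = 3 ^ suc t
  instance
    M-nonZero : NonZero M
    M-nonZero = 3^-nonZero (suc t)
  induction-hypothesis : powerSum e M % M ≡ (2 * 3 ^ t) % M
  induction-hypothesis = powerSum-3^ e 2^e≡1 t
  *-comm-assoc : ∀ a b c → a * (b * c) ≡ b * (a * c)
  *-comm-assoc = solve-∀

2^even≡1 : ∀ q → 2 ^ (2 * q) % 3 ≡ 1
2^even≡1 q = trans (cong (_% 3) (sym (^-*-assoc 2 2 q))) (^-one-mod {a = 4} refl q)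

3^-odd : ∀ t → ∃ λ q → 3 ^ t ≡ 1 + 2 * q
3^-odd zero    = 0 , refl
3^-odd (suc t) with 3^-odd t
... | q , 3^t≡1+2q = 1 + 3 * q , trans (cong (3 *_) 3^t≡1+2q) (triple q)
  where triple : ∀ q → 3 * (1 + 2 * q) ≡ 1 + 2 * (1 + 3 * q)
        triple = solve-∀

n<3^n : ∀ n → n < 3 ^ n
n<3^n zero    = s≤s z≤n
n<3^n (suc n) = ≤-trans (+-mono-≤ (m^n>0 3 n) (n<3^n n)) (+-monoʳ-≤ (3 ^ n) (m≤m+n (3 ^ n) _))

proposition2p2 : ∀ (m : ℕ) → ∃ λ n → m < n × WeakCarmichael n
proposition2p2 m = n , m<n , n-composite , congruence
  where
  t n : ℕ
  t = suc m
  n = 3 ^ suc t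
  instance
    n-nonZero : NonZero n
    n-nonZero = 3^-nonZero (suc t)
  1<3 : 1 < 3
  1<3 = s≤s (s≤s z≤n)
  m<n : m < n
  m<n = <-trans (n<3^n m) (^-monoʳ-< 3 1<3 (<-trans (n<1+n m) (n<1+n t)))
  -- 3 is a proper divisor of n, as 3 = 3·3^0 < 3·3^t.
  n-composite : Composite n
  n-composite = composite {3} (*-monoʳ-< 3 (^-monoʳ-< 3 1<3 {0} {t} z<s)) (m∣m*n (3 ^ t))
  -- n is odd, so the exponent n - 1 is even.
  n-1-even : 2 ^ (n ∸ 1) % 3 ≡ 1
  n-1-even with 3^-odd (suc t)
  ... | q , n≡1+2q rewrite n≡1+2q = 2^even≡1 q
  F : ℕ → ℕ
  F = _^ (n ∸ 1)
  congruence : coprimeSum n F (n ∸ 1) % n ≡ φ n % n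
  congruence = begin
    coprimeSum n F (n ∸ 1) % n
      ≡⟨ cong (_% n) (coprimeSum-primePower prime3 t F (n ∸ 1)) ⟩
    Sum (primeTo 3 F) (n ∸ 1) % n
      ≡⟨ cong (_% n) (Sum-primeTo-drop F n (m∣m*n (3 ^ t))) ⟩
    powerSum (n ∸ 1) n % n
      ≡⟨ powerSum-3^ (n ∸ 1) n-1-even t ⟩
    (2 * 3 ^ t) % n
      ≡⟨ powerSum-3^ 0 refl t ⟨
    powerSum 0 n % n
      ≡⟨ cong (_% n) (coprimeSum-primePower prime3 t (λ _ → 1) n) ⟨
    φ n % n
      ∎
    where
    prime3 : Prime 3
    prime3 = from-yes (prime? 3)
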